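{- For all $L,M\in\{0,1,2,\dots\}$, $$\sum_{j=-\infty}^{\infty}(-1)^j q^{\frac12 j(j+1)}\,\mathcal{U}(L,M,j,j)=\delta_{M,0}.$$
   Context: The Gaussian polynomial is $\left[\begin{smallmatrix}m+n\\ m\end{smallmatrix}\right]=\prod_{k=1}^m\frac{1-q^{n+k}}{1-q^k}$ if $m,n\in\{0,1,2,\dots\}$ and $0$ otherwise. For integers $L,M,a,b$, $$\mathcal{T}(L,M,a,b)=\sum_{\substack{n=0\\ n+a+L\ \text{even}}}^{L} q^{\frac12 n^2}\begin{bmatrix}M\\ n\end{bmatrix}\begin{bmatrix}M+b+(L-a-n)/2\\ M+b\end{bmatrix}\begin{bmatrix}M-b+(L+a-n)/2\\ M-b\end{bmatrix},$$ and $\mathcal{U}(L,M,a,b)=\mathcal{T}(L,M,a,b)+\mathcal{T}(L,M,a+1,b)$. -}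

module Defs where

open import Data.Nat as ℕ using (ℕ; zero; suc; _∸_)
open import Data.Nat.DivMod using (_%_; _/_)
open import Data.Integer as ℤ using (ℤ; +_; -[1+_]; ∣_∣)
open import Data.Bool using (Bool; true; false; if_then_else_)
open import Relation.Nullary.Decidable using (does)
open import Relation.Binary.PropositionalEquality using (_≡_)

-- Formal power series in t, where t = q^(1/2), with integer coefficients,
-- represented by their coefficient sequence.  All objects in the statement
-- are polynomials in q^(1/2) with nonnegative exponents, so this is enough.
Series : Set
Series = ℕ → ℤ

_≋_ : Series → Series → Set
f ≋ g = ∀ k → f k ≡ g k

0S : Series
0S _ = + 0

tpow : ℕ → Series
tpow e k = if does (k ℕ.≟ e) then + 1 else + 0

1S : Series
1S = tpow 0

_⊕_ : Series → Series → Series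
(f ⊕ g) k = f k ℤ.+ g k

_⊖_ : Series → Series → Series
(f ⊖ g) k = f k ℤ.- g k

scale : ℤ → Series → Series
scale c f k = c ℤ.* f k

sumℕ : ℕ → (ℕ → ℤ) → ℤ
sumℕ zero    h = + 0
sumℕ (suc n) h = sumℕ n h ℤ.+ h n

_⊗_ : Series → Series → Series
(f ⊗ g) k = sumℕ (suc k) (λ i → f i ℤ.* g (k ∸ i))

-- 1 / (1 - q^(suc i)) = sum_{r ≥ 0} q^(r (suc i)) = sum_r t^(2 r (suc i))
geomInv : ℕ → Series
geomInv i k = if does (k % suc (suc (2 ℕ.* i)) ℕ.≟ 0) then + 1 else + 0

-- Gaussian polynomial [m+n ; m] = prod_{k=1}^m (1 - q^(n+k)) / (1 - q^k), m n ∈ ℕ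
gaussMN : ℕ → ℕ → Series
gaussMN zero    n = 1S
gaussMN (suc i) n =
  gaussMN i n ⊗ ((1S ⊖ tpow (2 ℕ.* (n ℕ.+ suc i))) ⊗ geomInv i)

-- [top ; bot] for integers: = [m+n ; m] with m = bot, n = top - bot if both ≥ 0,
-- and 0 otherwise
gauss : ℤ → ℤ → Series
gauss top bot with bot | top ℤ.- bot
... | + m | + n = gaussMN m n
... | _   | _   = 0S

-- exact half of an even integer (floor halving)
half : ℤ → ℤ
half (+ n)      = + (n / 2)
half -[1+ n ]   = ℤ.- (+ (suc n / 2))

isEven : ℤ → Bool
isEven x = does (∣ x ∣ % 2 ℕ.≟ 0)

𝒯 : ℕ → ℕ → ℤ → ℤ → Series
𝒯 L M a b k = sumℕ (suc L) (λ n → summand n k)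
  where
  summand : ℕ → Series
  summand n =
    if isEven (+ n ℤ.+ a ℤ.+ + L)
    then tpow (n ℕ.* n)
         ⊗ (gauss (+ M) (+ n)
         ⊗ (gauss (+ M ℤ.+ b ℤ.+ half (+ L ℤ.- a ℤ.- + n)) (+ M ℤ.+ b)
         ⊗  gauss (+ M ℤ.- b ℤ.+ half (+ L ℤ.+ a ℤ.- + n)) (+ M ℤ.- b)))
    else 0S

𝒰 : ℕ → ℕ → ℤ → ℤ → Series
𝒰 L M a b = 𝒯 L M a b ⊕ 𝒯 L M (a ℤ.+ + 1) b

sgn : ℤ → ℤ
sgn j = if isEven j then + 1 else ℤ.- + 1

symSum : ℕ → (ℤ → Series) → Series
symSum zero    F = F (+ 0)
symSum (suc N) F = (symSum N F ⊕ F (+ suc N)) ⊕ F (ℤ.- + suc N)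

δ0 : ℕ → Series
δ0 zero    = 1S
δ0 (suc _) = 0S

-- the summand (-1)^j q^(j(j+1)/2) 𝒰(L,M,j,j)   (j(j+1) ≥ 0, so t^(j(j+1)) = t^|j(j+1)|)
lemmaTerm : ℕ → ℕ → ℤ → Series
lemmaTerm L M j = scale (sgn j) (tpow ∣ j ℤ.* (j ℤ.+ + 1) ∣ ⊗ 𝒰 L M j j)

module Submission where

-- Put G(x, a) = [⌊(x + a)/2⌋ ; a].  For n ≤ L exactly one of the n-th terms of 𝒯(L, M, j, j) and
-- 𝒯(L, M, j + 1, j) survives the parity condition, and together they equal
-- q^(n²/2) [M ; n] G(x, M + j) G(x + 1, M - j) with x = L - n + M.  Hence the sum over j is
-- Σ_n q^(n²/2) [M ; n] S(x, M), where S(x, M) = Σ_j (-1)^j q^(j(j+1)/2) G(x, M + j) G(x + 1, M - j).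
-- The q-Pascal rule G(x + 2, a) = G(x + 1, a - 1) + q^a G(x, a) splits S(x + 1, M) into a part that is
-- antisymmetric under j ↦ -1 - j, hence vanishes, and a part that becomes q^M S(x, M) under j ↦ -j.
-- As S(x, 0) = 1 and S(0, M) = 0 for M > 0, S(x, M) = δ_{M,0}, and only n = 0 remains.
-- Terms with |j| > M vanish since one of the Gaussian polynomials then has a negative lower entry.

open import Defs
open import Data.Nat using (ℕ; _<_)
open import Data.Integer using (ℤ; ∣_∣)
open import Data.Product using (Σ; _×_)

open import Algebra.Bundles using (CommutativeRing)
import Algebra.Solver.Ring
import Algebra.Solver.Ring.AlmostCommutativeRing as ACR
open import Data.Bool using (Bool; true; false; if_then_else_)
open import Data.Integer as ℤ using (+_; -[1+_]; +≤+)
import Data.Integer.Properties as ℤ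
open import Data.Integer.Tactic.RingSolver using (solve-∀)
open import Data.Maybe using (Maybe; just; nothing)
open import Data.Nat as ℕ using (zero; suc; _∸_; _≤_; z≤n; s≤s; ⌊_/2⌋)
import Data.Nat.Properties as ℕ
open import Data.Nat.DivMod using (_%_; _/_; m≤n⇒[n∸m]%m≡n%m; m<n⇒m%n≡m; m*n/n≡m; m*n%n≡0; [m+kn]%n≡m%n)
open import Data.Product using (_,_)
open import Data.Sum using (inj₁; inj₂)
open import Function using (_∘_)
open import Relation.Binary.PropositionalEquality
open import Relation.Nullary using (yes; no)
open import Relation.Nullary.Decidable using (does; dec-true; dec-false)
import Relation.Binary.Reasoning.Setoid as SetoidReasoning

sumℕ-cong : ∀ n {f g : ℕ → ℤ} → (∀ i → i < n → f i ≡ g i) → sumℕ n f ≡ sumℕ n g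
sumℕ-cong zero    eq = refl
sumℕ-cong (suc n) eq = cong₂ ℤ._+_ (sumℕ-cong n (λ i i<n → eq i (ℕ.m<n⇒m<1+n i<n))) (eq n ℕ.≤-refl)

sumℕ-zero : ∀ n {f : ℕ → ℤ} → (∀ i → i < n → f i ≡ + 0) → sumℕ n f ≡ + 0
sumℕ-zero zero    eq = refl
sumℕ-zero (suc n) eq rewrite sumℕ-zero n (λ i i<n → eq i (ℕ.m<n⇒m<1+n i<n)) | eq n ℕ.≤-refl = refl

sumℕ-distrib-+ : ∀ n (f g : ℕ → ℤ) → sumℕ n (λ i → f i ℤ.+ g i) ≡ sumℕ n f ℤ.+ sumℕ n g
sumℕ-distrib-+ zero    f g = refl
sumℕ-distrib-+ (suc n) f g rewrite sumℕ-distrib-+ n f g = interchange (sumℕ n f) (sumℕ n g) (f n) (g n)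
  where
  interchange : ∀ a b c d → (a ℤ.+ b) ℤ.+ (c ℤ.+ d) ≡ (a ℤ.+ c) ℤ.+ (b ℤ.+ d)
  interchange = solve-∀

*-distribˡ-sumℕ : ∀ n c (f : ℕ → ℤ) → c ℤ.* sumℕ n f ≡ sumℕ n (λ i → c ℤ.* f i)
*-distribˡ-sumℕ zero    c f = ℤ.*-zeroʳ c
*-distribˡ-sumℕ (suc n) c f =
  trans (ℤ.*-distribˡ-+ c (sumℕ n f) (f n)) (cong (ℤ._+ c ℤ.* f n) (*-distribˡ-sumℕ n c f))

sumℕ-head : ∀ n (f : ℕ → ℤ) → sumℕ (suc n) f ≡ f 0 ℤ.+ sumℕ n (f ∘ suc)
sumℕ-head zero    f = ℤ.+-comm (+ 0) (f 0)
sumℕ-head (suc n) f rewrite sumℕ-head n f = ℤ.+-assoc (f 0) _ _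

sumℕ-reverse : ∀ n (f : ℕ → ℤ) → sumℕ n f ≡ sumℕ n (λ i → f (n ∸ suc i))
sumℕ-reverse zero    f = refl
sumℕ-reverse (suc n) f = begin
  sumℕ n f ℤ.+ f n                          ≡⟨ cong (ℤ._+ f n) (sumℕ-reverse n f) ⟩
  sumℕ n (λ i → f (n ∸ suc i)) ℤ.+ f n      ≡⟨ ℤ.+-comm _ (f n) ⟩
  f n ℤ.+ sumℕ n (λ i → f (n ∸ suc i))      ≡⟨ sym (sumℕ-head n (λ i → f (suc n ∸ suc i))) ⟩
  sumℕ (suc n) (λ i → f (suc n ∸ suc i))    ∎
  where open ≡-Reasoning

sumℕ-triangle : ∀ n (A : ℕ → ℕ → ℤ) →
  sumℕ n (λ i → sumℕ (suc i) (λ l → A l i)) ≡ sumℕ n (λ l → sumℕ (n ∸ l) (λ m → A l (l ℕ.+ m)))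
sumℕ-triangle zero    A = refl
sumℕ-triangle (suc n) A = begin
  sumℕ n (λ i → sumℕ (suc i) (λ l → A l i)) ℤ.+ sumℕ (suc n) (λ l → A l n)
    ≡⟨ cong (ℤ._+ sumℕ (suc n) (λ l → A l n)) (sumℕ-triangle n A) ⟩
  sumℕ n rows ℤ.+ sumℕ (suc n) (λ l → A l n)
    ≡⟨ cong (ℤ._+ sumℕ (suc n) (λ l → A l n)) (sym last-row-empty) ⟩
  sumℕ (suc n) rows ℤ.+ sumℕ (suc n) (λ l → A l n)
    ≡⟨ sym (sumℕ-distrib-+ (suc n) rows (λ l → A l n)) ⟩
  sumℕ (suc n) (λ l → rows l ℤ.+ A l n)
    ≡⟨ sumℕ-cong (suc n) extend-row ⟩
  sumℕ (suc n) (λ l → sumℕ (suc n ∸ l) (λ m → A l (l ℕ.+ m))) ∎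
  where
  open ≡-Reasoning
  rows : ℕ → ℤ
  rows l = sumℕ (n ∸ l) (λ m → A l (l ℕ.+ m))
  last-row-empty : sumℕ (suc n) rows ≡ sumℕ n rows
  last-row-empty rewrite ℕ.n∸n≡0 n = ℤ.+-identityʳ _
  extend-row : ∀ l → l < suc n → rows l ℤ.+ A l n ≡ sumℕ (suc n ∸ l) (λ m → A l (l ℕ.+ m))
  extend-row l (s≤s l≤n) rewrite ℕ.+-∸-assoc 1 l≤n = cong (λ z → rows l ℤ.+ A l z) (sym (ℕ.m+[n∸m]≡n l≤n))

≋-refl : ∀ {f} → f ≋ f
≋-refl k = refl

≋-sym : ∀ {f g} → f ≋ g → g ≋ f
≋-sym p k = sym (p k)

≋-trans : ∀ {f g h} → f ≋ g → g ≋ h → f ≋ h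
≋-trans p q k = trans (p k) (q k)

≡⇒≋ : ∀ {f g} → f ≡ g → f ≋ g
≡⇒≋ refl k = refl

negS : Series → Series
negS f k = ℤ.- f k

⊕-cong : ∀ {f f′ g g′} → f ≋ f′ → g ≋ g′ → (f ⊕ g) ≋ (f′ ⊕ g′)
⊕-cong p q k = cong₂ ℤ._+_ (p k) (q k)

⊗-cong : ∀ {f f′ g g′} → f ≋ f′ → g ≋ g′ → (f ⊗ g) ≋ (f′ ⊗ g′)
⊗-cong p q k = sumℕ-cong (suc k) (λ i _ → cong₂ ℤ._*_ (p i) (q (k ∸ i)))

⊗-comm : ∀ f g → (f ⊗ g) ≋ (g ⊗ f)
⊗-comm f g k = trans (sumℕ-reverse (suc k) _) (sumℕ-cong (suc k) swap)
  where
  swap : ∀ i → i < suc k → f (k ∸ i) ℤ.* g (k ∸ (k ∸ i)) ≡ g i ℤ.* f (k ∸ i)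
  swap i (s≤s i≤k) rewrite ℕ.m∸[m∸n]≡n i≤k = ℤ.*-comm (f (k ∸ i)) (g i)

⊗-assoc : ∀ f g h → ((f ⊗ g) ⊗ h) ≋ (f ⊗ (g ⊗ h))
⊗-assoc f g h k = begin
  sumℕ (suc k) (λ i → sumℕ (suc i) (λ l → f l ℤ.* g (i ∸ l)) ℤ.* h (k ∸ i))
    ≡⟨ sumℕ-cong (suc k) (λ i _ → distribute i) ⟩
  sumℕ (suc k) (λ i → sumℕ (suc i) (λ l → A l i))
    ≡⟨ sumℕ-triangle (suc k) A ⟩
  sumℕ (suc k) (λ l → sumℕ (suc k ∸ l) (λ m → A l (l ℕ.+ m)))
    ≡⟨ sumℕ-cong (suc k) factor ⟩
  sumℕ (suc k) (λ l → f l ℤ.* sumℕ (suc (k ∸ l)) (λ m → g m ℤ.* h (k ∸ l ∸ m))) ∎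
  where
  open ≡-Reasoning
  A : ℕ → ℕ → ℤ
  A l i = f l ℤ.* (g (i ∸ l) ℤ.* h (k ∸ i))
  distribute : ∀ i → sumℕ (suc i) (λ l → f l ℤ.* g (i ∸ l)) ℤ.* h (k ∸ i) ≡ sumℕ (suc i) (λ l → A l i)
  distribute i = begin
    sumℕ (suc i) (λ l → f l ℤ.* g (i ∸ l)) ℤ.* h (k ∸ i)   ≡⟨ ℤ.*-comm _ (h (k ∸ i)) ⟩
    h (k ∸ i) ℤ.* sumℕ (suc i) (λ l → f l ℤ.* g (i ∸ l))   ≡⟨ *-distribˡ-sumℕ (suc i) (h (k ∸ i)) _ ⟩
    sumℕ (suc i) (λ l → h (k ∸ i) ℤ.* (f l ℤ.* g (i ∸ l))) ≡⟨ sumℕ-cong (suc i) (λ l _ → rotate (h (k ∸ i)) (f l) (g (i ∸ l))) ⟩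
    sumℕ (suc i) (λ l → A l i)                             ∎
    where
    rotate : ∀ a b c → a ℤ.* (b ℤ.* c) ≡ b ℤ.* (c ℤ.* a)
    rotate = solve-∀
  factor : ∀ l → l < suc k →
    sumℕ (suc k ∸ l) (λ m → A l (l ℕ.+ m)) ≡ f l ℤ.* sumℕ (suc (k ∸ l)) (λ m → g m ℤ.* h (k ∸ l ∸ m))
  factor l (s≤s l≤k) rewrite ℕ.+-∸-assoc 1 l≤k = begin
    sumℕ (suc (k ∸ l)) (λ m → A l (l ℕ.+ m))
      ≡⟨ sumℕ-cong (suc (k ∸ l)) (λ m _ → cong₂ (λ u v → f l ℤ.* (g u ℤ.* h v)) (ℕ.m+n∸m≡n l m) (sym (ℕ.∸-+-assoc k l m))) ⟩
    sumℕ (suc (k ∸ l)) (λ m → f l ℤ.* (g m ℤ.* h (k ∸ l ∸ m)))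
      ≡⟨ sym (*-distribˡ-sumℕ (suc (k ∸ l)) (f l) _) ⟩
    f l ℤ.* sumℕ (suc (k ∸ l)) (λ m → g m ℤ.* h (k ∸ l ∸ m)) ∎

⊗-distribˡ-⊕ : ∀ f g h → (f ⊗ (g ⊕ h)) ≋ ((f ⊗ g) ⊕ (f ⊗ h))
⊗-distribˡ-⊕ f g h k =
  trans (sumℕ-cong (suc k) (λ i _ → ℤ.*-distribˡ-+ (f i) (g (k ∸ i)) (h (k ∸ i)))) (sumℕ-distrib-+ (suc k) _ _)

tpow-≡ : ∀ {e i} → i ≡ e → tpow e i ≡ + 1
tpow-≡ {e} {i} i≡e = cong (if_then + 1 else + 0) (dec-true (i ℕ.≟ e) i≡e)

tpow-≢ : ∀ {e i} → i ≢ e → tpow e i ≡ + 0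
tpow-≢ {e} {i} i≢e = cong (if_then + 1 else + 0) (dec-false (i ℕ.≟ e) i≢e)

sumℕ-tpow-≤ : ∀ {n e} (h : ℕ → ℤ) → n ≤ e → sumℕ n (λ i → tpow e i ℤ.* h i) ≡ + 0
sumℕ-tpow-≤ {n} h n≤e = sumℕ-zero n (λ i i<n → cong (ℤ._* h i) (tpow-≢ (ℕ.<⇒≢ (ℕ.<-≤-trans i<n n≤e))))

sumℕ-tpow-> : ∀ {n e} (h : ℕ → ℤ) → e < n → sumℕ n (λ i → tpow e i ℤ.* h i) ≡ h e
sumℕ-tpow-> {suc n} {e} h (s≤s e≤n) with ℕ.m≤n⇒m<n∨m≡n e≤n
... | inj₁ e<n rewrite sumℕ-tpow-> h e<n | tpow-≢ {e} {n} (ℕ.>⇒≢ e<n) = ℤ.+-identityʳ (h e)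
... | inj₂ refl rewrite sumℕ-tpow-≤ {n} h ℕ.≤-refl | tpow-≡ {n} refl = trans (ℤ.+-identityˡ _) (ℤ.*-identityˡ (h n))

tpow-⊗-< : ∀ e f k → k < e → (tpow e ⊗ f) k ≡ + 0
tpow-⊗-< e f k k<e = sumℕ-tpow-≤ (λ i → f (k ∸ i)) k<e

tpow-⊗-≥ : ∀ e f k → e ≤ k → (tpow e ⊗ f) k ≡ f (k ∸ e)
tpow-⊗-≥ e f k e≤k = sumℕ-tpow-> (λ i → f (k ∸ i)) (s≤s e≤k)

⊗-identityˡ : ∀ f → (1S ⊗ f) ≋ f
⊗-identityˡ f k = tpow-⊗-≥ 0 f k z≤n

tpow-+ : ∀ a b → (tpow a ⊗ tpow b) ≋ tpow (a ℕ.+ b)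
tpow-+ a b k with a ℕ.≤? k
... | yes a≤k = trans (tpow-⊗-≥ a (tpow b) k a≤k) (shift (k ∸ a) (ℕ.m+[n∸m]≡n a≤k))
  where
  shift : ∀ r → a ℕ.+ r ≡ k → tpow b r ≡ tpow (a ℕ.+ b) k
  shift r refl with r ℕ.≟ b
  ... | yes r≡b = trans (tpow-≡ r≡b) (sym (tpow-≡ (cong (a ℕ.+_) r≡b)))
  ... | no  r≢b = trans (tpow-≢ r≢b) (sym (tpow-≢ (r≢b ∘ ℕ.+-cancelˡ-≡ a _ _)))
... | no  a≰k = trans (tpow-⊗-< a (tpow b) k (ℕ.≰⇒> a≰k))
                      (sym (tpow-≢ (λ k≡a+b → a≰k (subst (a ≤_) (sym k≡a+b) (ℕ.m≤m+n a b)))))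

⊗-identityʳ : ∀ f → (f ⊗ 1S) ≋ f
⊗-identityʳ f k = trans (⊗-comm f 1S k) (⊗-identityˡ f k)

⊗-distribʳ-⊕ : ∀ f g h → ((g ⊕ h) ⊗ f) ≋ ((g ⊗ f) ⊕ (h ⊗ f))
⊗-distribʳ-⊕ f g h k =
  trans (⊗-comm (g ⊕ h) f k) (trans (⊗-distribˡ-⊕ f g h k) (cong₂ ℤ._+_ (⊗-comm f g k) (⊗-comm f h k)))

⊗-zeroˡ : ∀ f → (0S ⊗ f) ≋ 0S
⊗-zeroˡ f k = sumℕ-zero (suc k) (λ _ _ → refl)

⊗-zeroʳ : ∀ f → (f ⊗ 0S) ≋ 0S
⊗-zeroʳ f k = trans (⊗-comm f 0S k) (⊗-zeroˡ f k)

⊕⊗-zeroʳ : ∀ g f → (g ⊕ (f ⊗ 0S)) ≋ g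
⊕⊗-zeroʳ g f k = trans (cong (λ z → g k ℤ.+ z) (⊗-zeroʳ f k)) (ℤ.+-identityʳ (g k))

seriesRing : CommutativeRing _ _
seriesRing = record
  { Carrier = Series ; _≈_ = _≋_ ; _+_ = _⊕_ ; _*_ = _⊗_ ; -_ = negS ; 0# = 0S ; 1# = 1S
  ; isCommutativeRing = record
    { isRing = record
      { +-isAbelianGroup = record
        { isGroup = record
          { isMonoid = record
            { isSemigroup = record
              { isMagma = record
                { isEquivalence = record
                  { refl = λ {f} → ≋-refl {f} ; sym = λ {f} {g} → ≋-sym {f} {g} ; trans = λ {f} {g} {h} → ≋-trans {f} {g} {h} }
                ; ∙-cong = λ {f} {f′} {g} {g′} → ⊕-cong {f} {f′} {g} {g′} }
              ; assoc = λ f g h k → ℤ.+-assoc (f k) (g k) (h k) }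
            ; identity = (λ f k → ℤ.+-identityˡ (f k)) , (λ f k → ℤ.+-identityʳ (f k)) }
          ; inverse = (λ f k → ℤ.+-inverseˡ (f k)) , (λ f k → ℤ.+-inverseʳ (f k))
          ; ⁻¹-cong = λ p k → cong ℤ.-_ (p k) }
        ; comm = λ f g k → ℤ.+-comm (f k) (g k) }
      ; *-cong = λ {f} {f′} {g} {g′} → ⊗-cong {f} {f′} {g} {g′}
      ; *-assoc = ⊗-assoc
      ; *-identity = ⊗-identityˡ , ⊗-identityʳ
      ; distrib = ⊗-distribˡ-⊕ , ⊗-distribʳ-⊕ }
    ; *-comm = ⊗-comm } }

module ≋-Reasoning = SetoidReasoning (CommutativeRing.setoid seriesRing)

⊕-congˡ : ∀ f {g h} → g ≋ h → (f ⊕ g) ≋ (f ⊕ h)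
⊕-congˡ f p k = cong (λ z → f k ℤ.+ z) (p k)

⊕-congʳ : ∀ h {f g} → f ≋ g → (f ⊕ h) ≋ (g ⊕ h)
⊕-congʳ h p k = cong (ℤ._+ h k) (p k)

⊗-congˡ : ∀ f {g h} → g ≋ h → (f ⊗ g) ≋ (f ⊗ h)
⊗-congˡ f = ⊗-cong {f} {f} (≋-refl {f})

⊗-congʳ : ∀ h {f g} → f ≋ g → (f ⊗ h) ≋ (g ⊗ h)
⊗-congʳ h p = ⊗-cong p (≋-refl {h})

scale-cong : ∀ c {f g} → f ≋ g → scale c f ≋ scale c g
scale-cong c p k = cong (c ℤ.*_) (p k)

constS : ℤ → Series
constS c = scale c 1S

scale≋constS-⊗ : ∀ c f → scale c f ≋ (constS c ⊗ f)
scale≋constS-⊗ c f k = sym (begin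
  sumℕ (suc k) (λ i → (c ℤ.* 1S i) ℤ.* f (k ∸ i)) ≡⟨ sumℕ-cong (suc k) (λ i _ → ℤ.*-assoc c (1S i) (f (k ∸ i))) ⟩
  sumℕ (suc k) (λ i → c ℤ.* (1S i ℤ.* f (k ∸ i))) ≡⟨ sym (*-distribˡ-sumℕ (suc k) c _) ⟩
  c ℤ.* (1S ⊗ f) k                                 ≡⟨ cong (c ℤ.*_) (⊗-identityˡ f k) ⟩
  c ℤ.* f k                                        ∎)
  where open ≡-Reasoning

constS-homomorphism : ACR._-Raw-AlmostCommutative⟶_ ℤ.+-*-rawRing (ACR.fromCommutativeRing seriesRing)
constS-homomorphism = record
  { ⟦_⟧ = constS
  ; +-homo = λ a b k → ℤ.*-distribʳ-+ (1S k) a b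
  ; *-homo = λ a b k → trans (ℤ.*-assoc a b (1S k)) (scale≋constS-⊗ a (constS b) k)
  ; -‿homo = λ a k → sym (ℤ.neg-distribˡ-* a (1S k))
  ; 0-homo = λ k → ℤ.*-zeroˡ (1S k)
  ; 1-homo = λ k → ℤ.*-identityˡ (1S k) }

constS-≟ : ∀ a b → Maybe (constS a ≋ constS b)
constS-≟ a b with a ℤ.≟ b
... | yes refl = just ≋-refl
... | no  _    = nothing

module SeriesSolver = Algebra.Solver.Ring ℤ.+-*-rawRing (ACR.fromCommutativeRing seriesRing) constS-homomorphism constS-≟
open SeriesSolver using (solve; _:+_; _:*_; _:-_; _:=_)

infix 25 q^_ 1-q^_

q^_ : ℕ → Series
q^ a = tpow (2 ℕ.* a)

1-q^_ : ℕ → Series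
1-q^ a = 1S ⊖ q^ a

q^-+ : ∀ a b → (q^ a ⊗ q^ b) ≋ q^ (a ℕ.+ b)
q^-+ a b = ≋-trans {q^ a ⊗ q^ b} (tpow-+ (2 ℕ.* a) (2 ℕ.* b)) (≡⇒≋ (cong tpow (sym (ℕ.*-distribˡ-+ 2 a b))))

1-q^-+ : ∀ a b → (1-q^ a ⊕ (q^ a ⊗ 1-q^ b)) ≋ 1-q^ (a ℕ.+ b)
1-q^-+ a b = begin
  1-q^ a ⊕ (q^ a ⊗ 1-q^ b)
    ≈⟨ solve 3 (λ x y u → (u :- x) :+ x :* (u :- y) := (u :- x) :+ (x :* u :- x :* y)) (λ k → refl) (q^ a) (q^ b) 1S ⟩
  1-q^ a ⊕ ((q^ a ⊗ 1S) ⊖ (q^ a ⊗ q^ b))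
    ≈⟨ ⊕-congˡ (1-q^ a) (⊕-congʳ _ (⊗-identityʳ (q^ a))) ⟩
  1-q^ a ⊕ (q^ a ⊖ (q^ a ⊗ q^ b))
    ≈⟨ (λ k → telescope (1S k) ((q^ a) k) _) ⟩
  1S ⊖ (q^ a ⊗ q^ b)
    ≈⟨ ⊕-congˡ 1S (λ k → cong ℤ.-_ (q^-+ a b k)) ⟩
  1-q^ (a ℕ.+ b) ∎
  where
  open ≋-Reasoning
  telescope : ∀ u x y → (u ℤ.- x) ℤ.+ (x ℤ.- y) ≡ u ℤ.- y
  telescope = solve-∀

-- geomInv i is the indicator of the multiples of 2 (i + 1), so a shift by 2 (i + 1) fixes it away from 0.
geomInv-telescope : ∀ i → (geomInv i ⊖ (q^ suc i ⊗ geomInv i)) ≋ 1S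
geomInv-telescope i k with 2 ℕ.* suc i ℕ.≤? k
... | yes p≤k = begin
  geomInv i k ℤ.- (q^ suc i ⊗ geomInv i) k        ≡⟨ cong (λ z → geomInv i k ℤ.- z) (tpow-⊗-≥ _ (geomInv i) k p≤k) ⟩
  geomInv i k ℤ.- geomInv i (k ∸ 2 ℕ.* suc i)     ≡⟨ cong (λ z → geomInv i k ℤ.- tpow 0 z) shift ⟩
  geomInv i k ℤ.- geomInv i k                      ≡⟨ ℤ.+-inverseʳ (geomInv i k) ⟩
  + 0                                              ≡⟨ sym (tpow-≢ (ℕ.>⇒≢ (ℕ.<-≤-trans {j = 2 ℕ.* suc i} ℕ.z<s p≤k))) ⟩
  1S k                                             ∎
  where
  open ≡-Reasoning
  period : 2 ℕ.* suc i ≡ suc (suc (2 ℕ.* i))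
  period = ℕ.*-suc 2 i
  shift : (k ∸ 2 ℕ.* suc i) % suc (suc (2 ℕ.* i)) ≡ k % suc (suc (2 ℕ.* i))
  shift = trans (cong (λ w → (k ∸ w) % suc (suc (2 ℕ.* i))) period) (m≤n⇒[n∸m]%m≡n%m (subst (_≤ k) period p≤k))
... | no  p≰k = trans (cong (λ z → geomInv i k ℤ.- z) (tpow-⊗-< _ (geomInv i) k k<p))
                      (trans (ℤ.+-identityʳ _) (cong (tpow 0) (m<n⇒m%n≡m (subst (k <_) period k<p))))
  where
  period : 2 ℕ.* suc i ≡ suc (suc (2 ℕ.* i))
  period = ℕ.*-suc 2 i
  k<p : k < 2 ℕ.* suc i
  k<p = ℕ.≰⇒> p≰k

geomInv-inverse : ∀ i → (geomInv i ⊗ 1-q^ suc i) ≋ 1S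
geomInv-inverse i = begin
  geomInv i ⊗ 1-q^ suc i
    ≈⟨ solve 3 (λ g x u → g :* (u :- x) := g :* u :- x :* g) (λ k → refl) (geomInv i) (q^ suc i) 1S ⟩
  (geomInv i ⊗ 1S) ⊖ (q^ suc i ⊗ geomInv i)
    ≈⟨ ⊕-congʳ _ (⊗-identityʳ (geomInv i)) ⟩
  geomInv i ⊖ (q^ suc i ⊗ geomInv i)
    ≈⟨ geomInv-telescope i ⟩
  1S ∎
  where open ≋-Reasoning

-- [m + n ; m] via the q-Pascal rule [N ; k] = [N - 1 ; k - 1] + q^k [N - 1 ; k]
gaussPascal : ℕ → ℕ → Series
gaussPascal zero    n       = 1S
gaussPascal (suc m) zero    = 1S
gaussPascal (suc m) (suc n) = gaussPascal m (suc n) ⊕ (q^ suc m ⊗ gaussPascal (suc m) n)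

gaussPascal-zeroʳ : ∀ m → gaussPascal m zero ≡ 1S
gaussPascal-zeroʳ zero    = refl
gaussPascal-zeroʳ (suc m) = refl

gaussPascal-sucˡ : ∀ m n → (gaussPascal (suc m) n ⊗ 1-q^ suc m) ≋ (gaussPascal m n ⊗ 1-q^ (n ℕ.+ suc m))
gaussPascal-sucʳ : ∀ m n → (gaussPascal m (suc n) ⊗ 1-q^ suc n) ≋ (gaussPascal m n ⊗ 1-q^ (n ℕ.+ suc m))

gaussPascal-sucˡ m zero rewrite gaussPascal-zeroʳ m = ≋-refl
gaussPascal-sucˡ m (suc n) = begin
  (A ⊕ (T ⊗ B)) ⊗ Dm
    ≈⟨ solve 4 (λ A T B Dm → (A :+ T :* B) :* Dm := A :* Dm :+ T :* (B :* Dm)) (λ k → refl) A T B Dm ⟩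
  (A ⊗ Dm) ⊕ (T ⊗ (B ⊗ Dm))
    ≈⟨ ⊕-congˡ (A ⊗ Dm) (⊗-congˡ T (≋-trans (gaussPascal-sucˡ m n) (≋-sym (gaussPascal-sucʳ m n)))) ⟩
  (A ⊗ Dm) ⊕ (T ⊗ (A ⊗ Dn))
    ≈⟨ solve 4 (λ A T Dn Dm → A :* Dm :+ T :* (A :* Dn) := A :* (Dm :+ T :* Dn)) (λ k → refl) A T Dn Dm ⟩
  A ⊗ (Dm ⊕ (T ⊗ Dn))
    ≈⟨ ⊗-congˡ A (1-q^-+ (suc m) (suc n)) ⟩
  A ⊗ 1-q^ (suc m ℕ.+ suc n)
    ≡⟨ cong (λ e → A ⊗ 1-q^ e) (ℕ.+-comm (suc m) (suc n)) ⟩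
  A ⊗ 1-q^ (suc n ℕ.+ suc m) ∎
  where
  open ≋-Reasoning
  A B T Dm Dn : Series
  A = gaussPascal m (suc n)
  B = gaussPascal (suc m) n
  T = q^ suc m
  Dm = 1-q^ suc m
  Dn = 1-q^ suc n

gaussPascal-sucʳ zero n rewrite ℕ.+-comm n 1 = ≋-refl
gaussPascal-sucʳ (suc m) n = begin
  (A ⊕ (T ⊗ B)) ⊗ Dn
    ≈⟨ solve 4 (λ A T B Dn → (A :+ T :* B) :* Dn := A :* Dn :+ T :* (B :* Dn)) (λ k → refl) A T B Dn ⟩
  (A ⊗ Dn) ⊕ (T ⊗ (B ⊗ Dn))
    ≈⟨ ⊕-congʳ (T ⊗ (B ⊗ Dn)) (≋-trans (gaussPascal-sucʳ m n) (≋-sym (gaussPascal-sucˡ m n))) ⟩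
  (B ⊗ Dm) ⊕ (T ⊗ (B ⊗ Dn))
    ≈⟨ solve 4 (λ B T Dn Dm → B :* Dm :+ T :* (B :* Dn) := B :* (Dm :+ T :* Dn)) (λ k → refl) B T Dn Dm ⟩
  B ⊗ (Dm ⊕ (T ⊗ Dn))
    ≈⟨ ⊗-congˡ B (1-q^-+ (suc m) (suc n)) ⟩
  B ⊗ 1-q^ (suc m ℕ.+ suc n)
    ≡⟨ cong (λ e → B ⊗ 1-q^ e) (trans (ℕ.+-comm (suc m) (suc n)) (sym (ℕ.+-suc n (suc m)))) ⟩
  B ⊗ 1-q^ (n ℕ.+ suc (suc m)) ∎
  where
  open ≋-Reasoning
  A B T Dm Dn : Series
  A = gaussPascal m (suc n)
  B = gaussPascal (suc m) n
  T = q^ suc m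
  Dm = 1-q^ suc m
  Dn = 1-q^ suc n

gaussMN≋gaussPascal : ∀ m n → gaussMN m n ≋ gaussPascal m n
gaussMN≋gaussPascal zero    n = ≋-refl
gaussMN≋gaussPascal (suc m) n = begin
  gaussMN m n ⊗ (1-q^ (n ℕ.+ suc m) ⊗ G)
    ≈⟨ ⊗-congʳ (1-q^ (n ℕ.+ suc m) ⊗ G) (gaussMN≋gaussPascal m n) ⟩
  gaussPascal m n ⊗ (1-q^ (n ℕ.+ suc m) ⊗ G)
    ≈⟨ solve 3 (λ X Y Z → X :* (Y :* Z) := (X :* Y) :* Z) (λ k → refl) (gaussPascal m n) (1-q^ (n ℕ.+ suc m)) G ⟩
  (gaussPascal m n ⊗ 1-q^ (n ℕ.+ suc m)) ⊗ G
    ≈⟨ ⊗-congʳ G (≋-sym (gaussPascal-sucˡ m n)) ⟩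
  (gaussPascal (suc m) n ⊗ 1-q^ suc m) ⊗ G
    ≈⟨ solve 3 (λ X Y Z → (X :* Y) :* Z := X :* (Z :* Y)) (λ k → refl) (gaussPascal (suc m) n) (1-q^ suc m) G ⟩
  gaussPascal (suc m) n ⊗ (G ⊗ 1-q^ suc m)
    ≈⟨ ⊗-congˡ (gaussPascal (suc m) n) (geomInv-inverse m) ⟩
  gaussPascal (suc m) n ⊗ 1S
    ≈⟨ ⊗-identityʳ (gaussPascal (suc m) n) ⟩
  gaussPascal (suc m) n ∎
  where
  open ≋-Reasoning
  G : Series
  G = geomInv m

-- gaussℤ b d is [b + d ; b] for b, d ≥ 0 and 0 otherwise
gaussℤ : ℤ → ℤ → Series
gaussℤ (+ m)     (+ n)     = gaussPascal m n
gaussℤ (+ m)     -[1+ n ]  = 0S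
gaussℤ -[1+ m ]  d         = 0S

gauss≋gaussℤ : ∀ T b → gauss T b ≋ gaussℤ b (T ℤ.- b)
gauss≋gaussℤ T b with b | T ℤ.- b
... | + m     | + n     = gaussMN≋gaussPascal m n
... | + m     | -[1+ n ] = ≋-refl
... | -[1+ m ] | _       = ≋-refl

gaussℤ-pascal : ∀ b d → (b ≡ + 0 → + 0 ℤ.≤ d) →
  gaussℤ b (+ 1 ℤ.+ d) ≋ (gaussℤ (b ℤ.- + 1) (+ 1 ℤ.+ d) ⊕ (q^ ∣ b ∣ ⊗ gaussℤ b d))
gaussℤ-pascal -[1+ m ]     d               _  = ≋-sym (⊕⊗-zeroʳ 0S (q^ suc m))
gaussℤ-pascal (+ zero)     (+ n)           _  = λ k → sym (trans (ℤ.+-identityˡ _) (⊗-identityˡ 1S k))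
gaussℤ-pascal (+ zero)     -[1+ n ]        0≤d with () ← 0≤d refl
gaussℤ-pascal (+ suc m)    (+ n)           _  = ≋-refl
gaussℤ-pascal (+ suc m)    -[1+ zero ]     _ rewrite gaussPascal-zeroʳ m = ≋-sym (⊕⊗-zeroʳ 1S (q^ suc m))
gaussℤ-pascal (+ suc m)    -[1+ suc n ]    _  = ≋-sym (⊕⊗-zeroʳ 0S (q^ suc m))

⌊_/2⌋ᶻ : ℤ → ℤ
⌊ + n      /2⌋ᶻ = + ⌊ n /2⌋
⌊ -[1+ n ] /2⌋ᶻ = -[1+ ⌊ n /2⌋ ]

⌊2+z/2⌋ᶻ : ∀ z → ⌊ + 2 ℤ.+ z /2⌋ᶻ ≡ + 1 ℤ.+ ⌊ z /2⌋ᶻ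
⌊2+z/2⌋ᶻ (+ n)              = refl
⌊2+z/2⌋ᶻ -[1+ zero ]        = refl
⌊2+z/2⌋ᶻ -[1+ suc zero ]    = refl
⌊2+z/2⌋ᶻ -[1+ suc (suc n) ] = refl

-- G x a = [⌊(x + a)/2⌋ ; a], written in the coordinates of gaussℤ
G : ℕ → ℤ → Series
G x a = gaussℤ a ⌊ + x ℤ.- a /2⌋ᶻ

G-pascal : ∀ x a → G (2 ℕ.+ x) a ≋ (G (1 ℕ.+ x) (a ℤ.- + 1) ⊕ (q^ ∣ a ∣ ⊗ G x a))
G-pascal x a = begin
  gaussℤ a ⌊ + (2 ℕ.+ x) ℤ.- a /2⌋ᶻ
    ≡⟨ cong (gaussℤ a) (trans (cong ⌊_/2⌋ᶻ (shift₁ (+ x) a)) (⌊2+z/2⌋ᶻ (+ x ℤ.- a))) ⟩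
  gaussℤ a (+ 1 ℤ.+ d)
    ≈⟨ gaussℤ-pascal a d (λ { refl → +≤+ z≤n }) ⟩
  gaussℤ (a ℤ.- + 1) (+ 1 ℤ.+ d) ⊕ (q^ ∣ a ∣ ⊗ gaussℤ a d)
    ≡⟨ cong (λ e → gaussℤ (a ℤ.- + 1) e ⊕ (q^ ∣ a ∣ ⊗ gaussℤ a d))
            (sym (trans (cong ⌊_/2⌋ᶻ (shift₂ (+ x) a)) (⌊2+z/2⌋ᶻ (+ x ℤ.- a)))) ⟩
  gaussℤ (a ℤ.- + 1) ⌊ + (1 ℕ.+ x) ℤ.- (a ℤ.- + 1) /2⌋ᶻ ⊕ (q^ ∣ a ∣ ⊗ gaussℤ a d) ∎
  where
  open ≋-Reasoning
  d : ℤ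
  d = ⌊ + x ℤ.- a /2⌋ᶻ
  shift₁ : ∀ x a → (+ 2 ℤ.+ x) ℤ.- a ≡ + 2 ℤ.+ (x ℤ.- a)
  shift₁ = solve-∀
  shift₂ : ∀ x a → (+ 1 ℤ.+ x) ℤ.- (a ℤ.- + 1) ≡ + 2 ℤ.+ (x ℤ.- a)
  shift₂ = solve-∀

2+[h+h]≡[1+h]+[1+h] : ∀ h → + 1 ℤ.+ (+ 1 ℤ.+ (h ℤ.+ h)) ≡ (+ 1 ℤ.+ h) ℤ.+ (+ 1 ℤ.+ h)
2+[h+h]≡[1+h]+[1+h] = solve-∀

data Parity (z : ℤ) : Set where
  even : ∀ h → z ≡ h ℤ.+ h → Parity z
  odd  : ∀ h → z ≡ + 1 ℤ.+ (h ℤ.+ h) → Parity z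

parity-suc : ∀ {z} → Parity z → Parity (+ 1 ℤ.+ z)
parity-suc (even h refl) = odd h refl
parity-suc (odd h refl) = even (+ 1 ℤ.+ h) (2+[h+h]≡[1+h]+[1+h] h)

parity-neg : ∀ {z} → Parity z → Parity (ℤ.- z)
parity-neg (even h refl) = even (ℤ.- h) (ℤ.neg-distrib-+ h h)
parity-neg (odd h refl) = odd (ℤ.- h ℤ.- + 1) (regroup h)
  where
  regroup : ∀ h → ℤ.- (+ 1 ℤ.+ (h ℤ.+ h)) ≡ + 1 ℤ.+ ((ℤ.- h ℤ.- + 1) ℤ.+ (ℤ.- h ℤ.- + 1))
  regroup = solve-∀

parityℕ : ∀ n → Parity (+ n)
parityℕ zero    = even (+ 0) refl
parityℕ (suc n) = parity-suc (parityℕ n)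

parity : ∀ z → Parity z
parity (+ n)      = parityℕ n
parity -[1+ n ]   = parity-neg (parityℕ (suc n))

m+m≡m*2 : ∀ m → m ℕ.+ m ≡ m ℕ.* 2
m+m≡m*2 m = trans (cong (m ℕ.+_) (sym (ℕ.*-identityʳ m))) (sym (ℕ.*-suc m 1))

⌊h+h/2⌋ᶻ : ∀ h → ⌊ h ℤ.+ h /2⌋ᶻ ≡ h
⌊h+h/2⌋ᶻ (+ m)      = cong +_ (sym (ℕ.n≡⌊n+n/2⌋ m))
⌊h+h/2⌋ᶻ -[1+ m ]   = cong -[1+_] (sym (ℕ.n≡⌈n+n/2⌉ m))

⌊1+h+h/2⌋ᶻ : ∀ h → ⌊ + 1 ℤ.+ (h ℤ.+ h) /2⌋ᶻ ≡ h
⌊1+h+h/2⌋ᶻ (+ m)      = cong +_ (sym (ℕ.n≡⌈n+n/2⌉ m))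
⌊1+h+h/2⌋ᶻ -[1+ m ]   = cong -[1+_] (sym (ℕ.n≡⌊n+n/2⌋ m))

half-h+h : ∀ h → half (h ℤ.+ h) ≡ h
half-h+h (+ m)      = cong +_ (trans (cong (_/ 2) (m+m≡m*2 m)) (m*n/n≡m m 2))
half-h+h -[1+ m ]   = cong (λ n → ℤ.- (+ n)) (trans (cong (_/ 2) (cong suc (sym (ℕ.+-suc m m)))) (trans (cong (_/ 2) (m+m≡m*2 (suc m))) (m*n/n≡m (suc m) 2)))

isEven-∣∣≡k+k : ∀ z k → ∣ z ∣ ≡ k ℕ.+ k → isEven z ≡ true
isEven-∣∣≡k+k z k eq = cong (λ r → does (r ℕ.≟ 0)) (trans (cong (_% 2) (trans eq (m+m≡m*2 k))) (m*n%n≡0 k 2))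

isEven-∣∣≡1+k+k : ∀ z k → ∣ z ∣ ≡ 1 ℕ.+ (k ℕ.+ k) → isEven z ≡ false
isEven-∣∣≡1+k+k z k eq = cong (λ r → does (r ℕ.≟ 0)) (trans (cong (_% 2) (trans eq (cong suc (m+m≡m*2 k)))) ([m+kn]%n≡m%n 1 k 2))

isEven-h+h : ∀ h → isEven (h ℤ.+ h) ≡ true
isEven-h+h h@(+ m)    = isEven-∣∣≡k+k (h ℤ.+ h) m refl
isEven-h+h h@(-[1+ m ]) = isEven-∣∣≡k+k (h ℤ.+ h) (suc m) (cong suc (sym (ℕ.+-suc m m)))

isEven-1+h+h : ∀ h → isEven (+ 1 ℤ.+ (h ℤ.+ h)) ≡ false
isEven-1+h+h h@(+ m)    = isEven-∣∣≡1+k+k (+ 1 ℤ.+ (h ℤ.+ h)) m refl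
isEven-1+h+h h@(-[1+ m ]) = isEven-∣∣≡1+k+k (+ 1 ℤ.+ (h ℤ.+ h)) m refl

sgn-neg : ∀ j → sgn (ℤ.- j) ≡ sgn j
sgn-neg j = cong (λ n → if does (n % 2 ℕ.≟ 0) then + 1 else ℤ.- + 1) (ℤ.∣-i∣≡∣i∣ j)

sgn-suc : ∀ j → sgn (+ 1 ℤ.+ j) ≡ ℤ.- sgn j
sgn-suc j with parity j
... | even h refl rewrite isEven-1+h+h h | isEven-h+h h = refl
... | odd  h refl rewrite 2+[h+h]≡[1+h]+[1+h] h | isEven-h+h (+ 1 ℤ.+ h) | isEven-1+h+h h = refl

-- j ↦ -1 - j pairs up the indices -N, ..., N - 1 of a symmetric sum
reflect : ℤ → ℤ
reflect j = ℤ.- (+ 1 ℤ.+ j)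

sgn-reflect : ∀ j → sgn (reflect j) ≡ ℤ.- sgn j
sgn-reflect j = trans (sgn-neg (+ 1 ℤ.+ j)) (sgn-suc j)

symSum-cong : ∀ N {A B : ℤ → Series} → (∀ j → A j ≋ B j) → symSum N A ≋ symSum N B
symSum-cong zero    eq k = eq (+ 0) k
symSum-cong (suc N) eq k = cong₂ ℤ._+_ (cong₂ ℤ._+_ (symSum-cong N eq k) (eq _ k)) (eq _ k)

symSum-zero : ∀ N {A : ℤ → Series} → (∀ j → A j ≋ 0S) → symSum N A ≋ 0S
symSum-zero zero    eq = eq (+ 0)
symSum-zero (suc N) eq k rewrite symSum-zero N eq k | eq (+ suc N) k | eq -[1+ N ] k = refl

symSum-distrib-⊕ : ∀ N (A B : ℤ → Series) → symSum N (λ j → A j ⊕ B j) ≋ (symSum N A ⊕ symSum N B)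
symSum-distrib-⊕ zero    A B k = refl
symSum-distrib-⊕ (suc N) A B k rewrite symSum-distrib-⊕ N A B k =
  regroup (symSum N A k) (symSum N B k) (A (+ suc N) k) (B (+ suc N) k) (A -[1+ N ] k) (B -[1+ N ] k)
  where
  regroup : ∀ a b c d e f → ((a ℤ.+ b) ℤ.+ (c ℤ.+ d)) ℤ.+ (e ℤ.+ f) ≡ ((a ℤ.+ c) ℤ.+ e) ℤ.+ ((b ℤ.+ d) ℤ.+ f)
  regroup = solve-∀

⊗-distribˡ-symSum : ∀ N c (A : ℤ → Series) → symSum N (λ j → c ⊗ A j) ≋ (c ⊗ symSum N A)
⊗-distribˡ-symSum zero    c A k = refl
⊗-distribˡ-symSum (suc N) c A k = begin
  (symSum N (λ j → c ⊗ A j) k ℤ.+ (c ⊗ A (+ suc N)) k) ℤ.+ (c ⊗ A -[1+ N ]) k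
    ≡⟨ cong (λ z → (z ℤ.+ (c ⊗ A (+ suc N)) k) ℤ.+ (c ⊗ A -[1+ N ]) k) (⊗-distribˡ-symSum N c A k) ⟩
  ((c ⊗ symSum N A) k ℤ.+ (c ⊗ A (+ suc N)) k) ℤ.+ (c ⊗ A -[1+ N ]) k
    ≡⟨ cong (ℤ._+ (c ⊗ A -[1+ N ]) k) (sym (⊗-distribˡ-⊕ c (symSum N A) (A (+ suc N)) k)) ⟩
  (c ⊗ (symSum N A ⊕ A (+ suc N))) k ℤ.+ (c ⊗ A -[1+ N ]) k
    ≡⟨ sym (⊗-distribˡ-⊕ c (symSum N A ⊕ A (+ suc N)) (A -[1+ N ]) k) ⟩
  (c ⊗ symSum (suc N) A) k ∎
  where open ≡-Reasoning

symSum-neg : ∀ N (A : ℤ → Series) → symSum N (λ j → A (ℤ.- j)) ≋ symSum N A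
symSum-neg zero    A k = refl
symSum-neg (suc N) A k rewrite symSum-neg N A k = swap (symSum N A k) (A -[1+ N ] k) (A (+ suc N) k)
  where
  swap : ∀ a b c → (a ℤ.+ b) ℤ.+ c ≡ (a ℤ.+ c) ℤ.+ b
  swap = solve-∀

symSum-antisymmetric : ∀ N (A : ℤ → Series) → (∀ j → A (reflect j) ≋ negS (A j)) → A (+ N) ≋ 0S → symSum N A ≋ 0S
symSum-antisymmetric N A anti A[N]≡0 k = begin
  symSum N A k                         ≡⟨ sym (ℤ.+-identityʳ _) ⟩
  symSum N A k ℤ.+ + 0                 ≡⟨ cong (λ z → symSum N A k ℤ.+ z) (sym (trans (anti (+ N) k) (cong ℤ.-_ (A[N]≡0 k)))) ⟩
  symSum N A k ℤ.+ A -[1+ N ] k        ≡⟨ cancel N ⟩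
  + 0                                  ∎
  where
  open ≡-Reasoning
  cancel : ∀ n → symSum n A k ℤ.+ A -[1+ n ] k ≡ + 0
  cancel zero    = trans (cong (λ z → A (+ 0) k ℤ.+ z) (anti (+ 0) k)) (ℤ.+-inverseʳ (A (+ 0) k))
  cancel (suc n) = begin
    ((symSum n A k ℤ.+ A (+ suc n) k) ℤ.+ A -[1+ n ] k) ℤ.+ A -[1+ suc n ] k
      ≡⟨ cong (λ z → ((symSum n A k ℤ.+ A (+ suc n) k) ℤ.+ A -[1+ n ] k) ℤ.+ z) (anti (+ suc n) k) ⟩
    ((symSum n A k ℤ.+ A (+ suc n) k) ℤ.+ A -[1+ n ] k) ℤ.- A (+ suc n) k
      ≡⟨ drop (symSum n A k) (A (+ suc n) k) (A -[1+ n ] k) ⟩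
    symSum n A k ℤ.+ A -[1+ n ] k
      ≡⟨ cancel n ⟩
    + 0 ∎
    where
    drop : ∀ a b c → ((a ℤ.+ b) ℤ.+ c) ℤ.- b ≡ a ℤ.+ c
    drop = solve-∀

-- t-exponent of q^(j (j + 1) / 2)
triangular : ℤ → ℕ
triangular j = ∣ j ℤ.* (j ℤ.+ + 1) ∣

+triangular : ∀ j → + triangular j ≡ j ℤ.* (j ℤ.+ + 1)
+triangular j = ℤ.0≤i⇒+∣i∣≡i (nonneg j)
  where
  nonneg : ∀ j → + 0 ℤ.≤ j ℤ.* (j ℤ.+ + 1)
  nonneg (+ n)            = subst (+ 0 ℤ.≤_) (ℤ.pos-* n (n ℕ.+ 1)) (+≤+ z≤n)
  nonneg -[1+ zero ]      = +≤+ z≤n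
  nonneg -[1+ suc n ]     = +≤+ z≤n

triangular-reflect : ∀ j → triangular (reflect j) ≡ triangular j
triangular-reflect j = cong ∣_∣ (reflect-invariant j)
  where
  reflect-invariant : ∀ j → ℤ.- (+ 1 ℤ.+ j) ℤ.* (ℤ.- (+ 1 ℤ.+ j) ℤ.+ + 1) ≡ j ℤ.* (j ℤ.+ + 1)
  reflect-invariant = solve-∀

triangular-neg : ∀ j M b → + M ℤ.+ j ≡ + b → triangular (ℤ.- j) ℕ.+ 2 ℕ.* b ≡ triangular j ℕ.+ 2 ℕ.* M
triangular-neg j M b M+j≡b = ℤ.+-injective (begin
  + (triangular (ℤ.- j) ℕ.+ 2 ℕ.* b)
    ≡⟨ ℤ.pos-+ (triangular (ℤ.- j)) (2 ℕ.* b) ⟩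
  + triangular (ℤ.- j) ℤ.+ + (2 ℕ.* b)
    ≡⟨ cong₂ ℤ._+_ (+triangular (ℤ.- j)) (trans (ℤ.pos-* 2 b) (cong (+ 2 ℤ.*_) (sym M+j≡b))) ⟩
  (ℤ.- j) ℤ.* ((ℤ.- j) ℤ.+ + 1) ℤ.+ + 2 ℤ.* (+ M ℤ.+ j)
    ≡⟨ expand j (+ M) ⟩
  j ℤ.* (j ℤ.+ + 1) ℤ.+ + 2 ℤ.* + M
    ≡⟨ sym (cong₂ ℤ._+_ (+triangular j) (ℤ.pos-* 2 M)) ⟩
  + triangular j ℤ.+ + (2 ℕ.* M)
    ≡⟨ sym (ℤ.pos-+ (triangular j) (2 ℕ.* M)) ⟩
  + (triangular j ℕ.+ 2 ℕ.* M) ∎)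
  where
  open ≡-Reasoning
  expand : ∀ j X → (ℤ.- j) ℤ.* ((ℤ.- j) ℤ.+ + 1) ℤ.+ + 2 ℤ.* (X ℤ.+ j) ≡ j ℤ.* (j ℤ.+ + 1) ℤ.+ + 2 ℤ.* X
  expand = solve-∀

altTerm : ℕ → ℕ → ℤ → Series
altTerm x M j = scale (sgn j) (tpow (triangular j) ⊗ (G x (+ M ℤ.+ j) ⊗ G (suc x) (+ M ℤ.- j)))

altSum : ℕ → ℕ → Series
altSum x M = symSum M (altTerm x M)

scale-⊗-vanishesˡ : ∀ c E {X} Y → X ≋ 0S → scale c (E ⊗ (X ⊗ Y)) ≋ 0S
scale-⊗-vanishesˡ c E {X} Y X≋0 k = begin
  c ℤ.* (E ⊗ (X ⊗ Y)) k   ≡⟨ cong (c ℤ.*_) (⊗-congˡ E (≋-trans (⊗-congʳ Y X≋0) (⊗-zeroˡ Y)) k) ⟩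
  c ℤ.* (E ⊗ 0S) k         ≡⟨ cong (c ℤ.*_) (⊗-zeroʳ E k) ⟩
  c ℤ.* + 0                ≡⟨ ℤ.*-zeroʳ c ⟩
  + 0                      ∎
  where open ≡-Reasoning

scale-⊗-vanishesʳ : ∀ c E X {Y} → Y ≋ 0S → scale c (E ⊗ (X ⊗ Y)) ≋ 0S
scale-⊗-vanishesʳ c E X {Y} Y≋0 k =
  trans (cong (c ℤ.*_) (⊗-congˡ E (⊗-comm X Y) k)) (scale-⊗-vanishesˡ c E X Y≋0 k)

antisymmetricPart shiftedPart : ℕ → ℕ → ℤ → Series
antisymmetricPart x M j =
  scale (sgn j) (tpow (triangular j) ⊗ (G (suc x) (+ M ℤ.+ j) ⊗ G (suc x) ((+ M ℤ.- j) ℤ.- + 1)))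
shiftedPart x M j =
  scale (sgn j) (tpow (triangular j) ⊗ (G (suc x) (+ M ℤ.+ j) ⊗ (q^ ∣ + M ℤ.- j ∣ ⊗ G x (+ M ℤ.- j))))

altTerm-split : ∀ x M j → altTerm (suc x) M j ≋ (antisymmetricPart x M j ⊕ shiftedPart x M j)
altTerm-split x M j = begin
  scale s (E ⊗ (G₁ ⊗ G (2 ℕ.+ x) (+ M ℤ.- j)))
    ≈⟨ scale-cong s (⊗-congˡ E (⊗-congˡ G₁ (G-pascal x (+ M ℤ.- j)))) ⟩
  scale s (E ⊗ (G₁ ⊗ (U ⊕ V)))
    ≈⟨ scale≋constS-⊗ s (E ⊗ (G₁ ⊗ (U ⊕ V))) ⟩
  constS s ⊗ (E ⊗ (G₁ ⊗ (U ⊕ V)))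
    ≈⟨ solve 5 (λ c E G U V → c :* (E :* (G :* (U :+ V))) := c :* (E :* (G :* U)) :+ c :* (E :* (G :* V)))
             (λ k → refl) (constS s) E G₁ U V ⟩
  (constS s ⊗ (E ⊗ (G₁ ⊗ U))) ⊕ (constS s ⊗ (E ⊗ (G₁ ⊗ V)))
    ≈⟨ ⊕-cong (≋-sym (scale≋constS-⊗ s (E ⊗ (G₁ ⊗ U)))) (≋-sym (scale≋constS-⊗ s (E ⊗ (G₁ ⊗ V)))) ⟩
  antisymmetricPart x M j ⊕ shiftedPart x M j ∎
  where
  open ≋-Reasoning
  s : ℤ
  s = sgn j
  E G₁ U V : Series
  E = tpow (triangular j)
  G₁ = G (suc x) (+ M ℤ.+ j)
  U = G (suc x) ((+ M ℤ.- j) ℤ.- + 1)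
  V = q^ ∣ + M ℤ.- j ∣ ⊗ G x (+ M ℤ.- j)

antisymmetricPart-reflect : ∀ x M j → antisymmetricPart x M (reflect j) ≋ negS (antisymmetricPart x M j)
antisymmetricPart-reflect x M j = begin
  antisymmetricPart x M (reflect j)
    ≡⟨ cong₂ (λ c e → scale c (tpow e ⊗ (G (suc x) (+ M ℤ.+ reflect j) ⊗ G (suc x) ((+ M ℤ.- reflect j) ℤ.- + 1))))
             (sgn-reflect j) (triangular-reflect j) ⟩
  scale (ℤ.- s) (E ⊗ (G (suc x) (+ M ℤ.+ reflect j) ⊗ G (suc x) ((+ M ℤ.- reflect j) ℤ.- + 1)))
    ≡⟨ cong₂ (λ a b → scale (ℤ.- s) (E ⊗ (G (suc x) a ⊗ G (suc x) b))) (swap₁ (+ M) j) (swap₂ (+ M) j) ⟩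
  scale (ℤ.- s) (E ⊗ (G₂ ⊗ G₁))
    ≈⟨ (λ k → sym (ℤ.neg-distribˡ-* s ((E ⊗ (G₂ ⊗ G₁)) k))) ⟩
  negS (scale s (E ⊗ (G₂ ⊗ G₁)))
    ≈⟨ (λ k → cong ℤ.-_ (scale-cong s (⊗-congˡ E (⊗-comm G₂ G₁)) k)) ⟩
  negS (antisymmetricPart x M j) ∎
  where
  open ≋-Reasoning
  s : ℤ
  s = sgn j
  E G₁ G₂ : Series
  E = tpow (triangular j)
  G₁ = G (suc x) (+ M ℤ.+ j)
  G₂ = G (suc x) ((+ M ℤ.- j) ℤ.- + 1)
  swap₁ : ∀ X j → X ℤ.+ ℤ.- (+ 1 ℤ.+ j) ≡ (X ℤ.- j) ℤ.- + 1
  swap₁ = solve-∀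
  swap₂ : ∀ X j → (X ℤ.- ℤ.- (+ 1 ℤ.+ j)) ℤ.- + 1 ≡ X ℤ.+ j
  swap₂ = solve-∀

antisymmetricPart-edge : ∀ x M → antisymmetricPart x M (+ M) ≋ 0S
antisymmetricPart-edge x M = scale-⊗-vanishesʳ (sgn (+ M)) (tpow (triangular (+ M))) (G (suc x) (+ M ℤ.+ + M))
  (≡⇒≋ (cong (λ a → G (suc x) (a ℤ.- + 1)) (ℤ.+-inverseʳ (+ M))))

shiftedPart-neg : ∀ x M j → shiftedPart x M (ℤ.- j) ≋ (q^ M ⊗ altTerm x M j)
shiftedPart-neg x M j = by-sign (+ M ℤ.+ j) refl
  where
  by-sign : ∀ a → + M ℤ.+ j ≡ a → shiftedPart x M (ℤ.- j) ≋ (q^ M ⊗ altTerm x M j)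
  by-sign -[1+ k ] M+j≡ = begin
    shiftedPart x M (ℤ.- j) ≈⟨ lhs≋0 ⟩
    0S                      ≈⟨ rhs≋0 ⟨
    q^ M ⊗ altTerm x M j    ∎
    where
    open ≋-Reasoning
    lhs≋0 : shiftedPart x M (ℤ.- j) ≋ 0S
    lhs≋0 = scale-⊗-vanishesʳ (sgn (ℤ.- j)) (tpow (triangular (ℤ.- j))) (G (suc x) (+ M ℤ.- j))
      (≋-trans (⊗-congˡ (q^ ∣ + M ℤ.- ℤ.- j ∣) (≡⇒≋ (cong (G x) (trans (cong (λ z → + M ℤ.+ z) (ℤ.neg-involutive j)) M+j≡))))
               (⊗-zeroʳ (q^ ∣ + M ℤ.- ℤ.- j ∣)))
    rhs≋0 : (q^ M ⊗ altTerm x M j) ≋ 0S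
    rhs≋0 = ≋-trans (⊗-congˡ (q^ M) (scale-⊗-vanishesˡ (sgn j) (tpow (triangular j)) (G (suc x) (+ M ℤ.- j))
                                                         (≡⇒≋ (cong (G x) M+j≡))))
                    (⊗-zeroʳ (q^ M))
  by-sign (+ b) M+j≡ = begin
    shiftedPart x M (ℤ.- j)
      ≡⟨ cong₂ (λ c a → scale c (E′ ⊗ (G₁ ⊗ (q^ ∣ a ∣ ⊗ G x (+ M ℤ.- ℤ.- j))))) (sgn-neg j) M-−j≡ ⟩
    scale s (E′ ⊗ (G₁ ⊗ (q^ b ⊗ G x (+ M ℤ.- ℤ.- j))))
      ≡⟨ cong (λ a → scale s (E′ ⊗ (G₁ ⊗ (q^ b ⊗ G x (+ M ℤ.+ a))))) (ℤ.neg-involutive j) ⟩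
    scale s (E′ ⊗ (G₁ ⊗ (q^ b ⊗ G₀)))
      ≈⟨ scale≋constS-⊗ s (E′ ⊗ (G₁ ⊗ (q^ b ⊗ G₀))) ⟩
    constS s ⊗ (E′ ⊗ (G₁ ⊗ (q^ b ⊗ G₀)))
      ≈⟨ solve 5 (λ c E G₁ T G₀ → c :* (E :* (G₁ :* (T :* G₀))) := c :* ((E :* T) :* (G₀ :* G₁)))
               (λ k → refl) (constS s) E′ G₁ (q^ b) G₀ ⟩
    constS s ⊗ ((E′ ⊗ q^ b) ⊗ (G₀ ⊗ G₁))
      ≈⟨ ⊗-congˡ (constS s) (⊗-congʳ (G₀ ⊗ G₁) exponents) ⟩
    constS s ⊗ ((E ⊗ q^ M) ⊗ (G₀ ⊗ G₁))
      ≈⟨ solve 5 (λ c E T G₀ G₁ → c :* ((E :* T) :* (G₀ :* G₁)) := T :* (c :* (E :* (G₀ :* G₁))))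
               (λ k → refl) (constS s) E (q^ M) G₀ G₁ ⟩
    q^ M ⊗ (constS s ⊗ (E ⊗ (G₀ ⊗ G₁)))
      ≈⟨ ⊗-congˡ (q^ M) (≋-sym (scale≋constS-⊗ s (E ⊗ (G₀ ⊗ G₁)))) ⟩
    q^ M ⊗ altTerm x M j ∎
    where
    open ≋-Reasoning
    s : ℤ
    s = sgn j
    E E′ G₁ G₀ : Series
    E = tpow (triangular j)
    E′ = tpow (triangular (ℤ.- j))
    G₁ = G (suc x) (+ M ℤ.- j)
    G₀ = G x (+ M ℤ.+ j)
    M-−j≡ : + M ℤ.- ℤ.- j ≡ + b
    M-−j≡ = trans (cong (λ z → + M ℤ.+ z) (ℤ.neg-involutive j)) M+j≡
    exponents : (E′ ⊗ q^ b) ≋ (E ⊗ q^ M)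
    exponents = begin
      E′ ⊗ q^ b                                     ≈⟨ tpow-+ (triangular (ℤ.- j)) (2 ℕ.* b) ⟩
      tpow (triangular (ℤ.- j) ℕ.+ 2 ℕ.* b)         ≡⟨ cong tpow (triangular-neg j M b M+j≡) ⟩
      tpow (triangular j ℕ.+ 2 ℕ.* M)               ≈⟨ ≋-sym (tpow-+ (triangular j) (2 ℕ.* M)) ⟩
      E ⊗ q^ M                                      ∎

altSum-sucˡ : ∀ x M → altSum (suc x) M ≋ (q^ M ⊗ altSum x M)
altSum-sucˡ x M = begin
  symSum M (altTerm (suc x) M)
    ≈⟨ symSum-cong M (altTerm-split x M) ⟩
  symSum M (λ j → antisymmetricPart x M j ⊕ shiftedPart x M j)
    ≈⟨ symSum-distrib-⊕ M (antisymmetricPart x M) (shiftedPart x M) ⟩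
  symSum M (antisymmetricPart x M) ⊕ symSum M (shiftedPart x M)
    ≈⟨ ⊕-congʳ (symSum M (shiftedPart x M))
         (symSum-antisymmetric M (antisymmetricPart x M) (antisymmetricPart-reflect x M) (antisymmetricPart-edge x M)) ⟩
  0S ⊕ symSum M (shiftedPart x M)
    ≈⟨ (λ k → ℤ.+-identityˡ _) ⟩
  symSum M (shiftedPart x M)
    ≈⟨ symSum-neg M (shiftedPart x M) ⟨
  symSum M (λ j → shiftedPart x M (ℤ.- j))
    ≈⟨ symSum-cong M (shiftedPart-neg x M) ⟩
  symSum M (λ j → q^ M ⊗ altTerm x M j)
    ≈⟨ ⊗-distribˡ-symSum M (q^ M) (altTerm x M) ⟩
  q^ M ⊗ altSum x M ∎
  where open ≋-Reasoning

-- for x = 0 the factor G(0, M + j) vanishes unless j = -M, and then G(1, 2M) vanishes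
altSum-zeroˡ-suc : ∀ m → altSum 0 (suc m) ≋ 0S
altSum-zeroˡ-suc m = symSum-zero (suc m) vanishes
  where
  M : ℕ
  M = suc m
  vanishes : ∀ j → altTerm 0 M j ≋ 0S
  vanishes j = by-sign (+ M ℤ.+ j) refl
    where
    by-sign : ∀ a → + M ℤ.+ j ≡ a → altTerm 0 M j ≋ 0S
    by-sign -[1+ k ]  M+j≡ = scale-⊗-vanishesˡ (sgn j) (tpow (triangular j)) (G 1 (+ M ℤ.- j)) (≡⇒≋ (cong (G 0) M+j≡))
    by-sign (+ suc n) M+j≡ = scale-⊗-vanishesˡ (sgn j) (tpow (triangular j)) (G 1 (+ M ℤ.- j)) (≡⇒≋ (cong (G 0) M+j≡))
    by-sign (+ zero)  M+j≡ = scale-⊗-vanishesʳ (sgn j) (tpow (triangular j)) (G 0 (+ M ℤ.+ j))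
      (≡⇒≋ (trans (cong (G 1) M-j≡M+M) G[1,M+M]≡0))
      where
      M-j≡M+M : + M ℤ.- j ≡ + (M ℕ.+ M)
      M-j≡M+M = trans (reorder (+ M) j) (trans (cong (λ z → (+ M ℤ.+ + M) ℤ.- z) M+j≡) (ℤ.+-identityʳ _))
        where
        reorder : ∀ X j → X ℤ.- j ≡ (X ℤ.+ X) ℤ.- (X ℤ.+ j)
        reorder = solve-∀
      G[1,M+M]≡0 : G 1 (+ (M ℕ.+ M)) ≡ 0S
      G[1,M+M]≡0 rewrite ℕ.+-suc m m = refl

altSum-zeroʳ : ∀ x → altSum x 0 ≋ 1S
altSum-zeroʳ x k = trans (ℤ.*-identityˡ _) (trans (⊗-identityˡ (1S ⊗ 1S) k) (⊗-identityˡ 1S k))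

altSum≋δ0 : ∀ x M → altSum x M ≋ δ0 M
altSum≋δ0 x       zero    = altSum-zeroʳ x
altSum≋δ0 zero    (suc m) = altSum-zeroˡ-suc m
altSum≋δ0 (suc x) (suc m) = ≋-trans (altSum-sucˡ x (suc m))
  (≋-trans (⊗-congˡ (q^ suc m) (altSum≋δ0 x (suc m))) (⊗-zeroʳ (q^ suc m)))

if-cong : ∀ {b b′ : Bool} {X Y : Series} → b ≡ b′ → X ≋ Y → (if b then X else 0S) ≋ (if b′ then Y else 0S)
if-cong {true}  refl X≋Y = X≋Y
if-cong {false} refl _   = ≋-refl

[h+h]+[c+c]≡[h+c]+[h+c] : ∀ h c → (h ℤ.+ h) ℤ.+ (c ℤ.+ c) ≡ (h ℤ.+ c) ℤ.+ (h ℤ.+ c)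
[h+h]+[c+c]≡[h+c]+[h+c] = solve-∀

[1+h+h]+[c+c]≡1+[h+c]+[h+c] : ∀ h c → (+ 1 ℤ.+ (h ℤ.+ h)) ℤ.+ (c ℤ.+ c) ≡ + 1 ℤ.+ ((h ℤ.+ c) ℤ.+ (h ℤ.+ c))
[1+h+h]+[c+c]≡1+[h+c]+[h+c] = solve-∀

[1+z]-1≡z : ∀ z → (+ 1 ℤ.+ z) ℤ.- + 1 ≡ z
[1+z]-1≡z = solve-∀

-- Exactly one of the two parity-guarded terms survives, and in it the exact halves are floors.
parity-select : ∀ (F : ℤ → ℤ → Series) w c d →
  ((if isEven (w ℤ.+ (d ℤ.+ d)) then F (half w) (half (w ℤ.+ (c ℤ.+ c))) else 0S) ⊕
   (if isEven (+ 1 ℤ.+ (w ℤ.+ (d ℤ.+ d))) then F (half (w ℤ.- + 1)) (half (+ 1 ℤ.+ (w ℤ.+ (c ℤ.+ c)))) else 0S))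
  ≋ F ⌊ w /2⌋ᶻ ⌊ + 1 ℤ.+ (w ℤ.+ (c ℤ.+ c)) /2⌋ᶻ
parity-select F w c d with parity w
... | even h refl
  rewrite [h+h]+[c+c]≡[h+c]+[h+c] h d | [h+h]+[c+c]≡[h+c]+[h+c] h c
        | isEven-h+h (h ℤ.+ d) | isEven-1+h+h (h ℤ.+ d)
        | half-h+h h | ⌊h+h/2⌋ᶻ h | half-h+h (h ℤ.+ c) | ⌊1+h+h/2⌋ᶻ (h ℤ.+ c)
  = λ k → ℤ.+-identityʳ _
... | odd h refl
  rewrite [1+h+h]+[c+c]≡1+[h+c]+[h+c] h d | [1+h+h]+[c+c]≡1+[h+c]+[h+c] h c
        | 2+[h+h]≡[1+h]+[1+h] (h ℤ.+ d) | 2+[h+h]≡[1+h]+[1+h] (h ℤ.+ c) | [1+z]-1≡z (h ℤ.+ h)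
        | isEven-1+h+h (h ℤ.+ d) | isEven-h+h (+ 1 ℤ.+ (h ℤ.+ d))
        | half-h+h h | ⌊1+h+h/2⌋ᶻ h | half-h+h (+ 1 ℤ.+ (h ℤ.+ c)) | ⌊h+h/2⌋ᶻ (+ 1 ℤ.+ (h ℤ.+ c))
  = λ k → ℤ.+-identityˡ _

gauss-+ : ∀ c e → gauss (c ℤ.+ e) c ≋ gaussℤ c e
gauss-+ c e = ≋-trans (gauss≋gaussℤ (c ℤ.+ e) c) (≡⇒≋ (cong (gaussℤ c) (c+e-c≡e c e)))
  where
  c+e-c≡e : ∀ c e → (c ℤ.+ e) ℤ.- c ≡ e
  c+e-c≡e = solve-∀

𝒯-summand : ℕ → ℕ → ℤ → ℤ → ℕ → Series
𝒯-summand L M a b n =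
  if isEven (+ n ℤ.+ a ℤ.+ + L)
  then tpow (n ℕ.* n)
       ⊗ (gauss (+ M) (+ n)
       ⊗ (gauss (+ M ℤ.+ b ℤ.+ half (+ L ℤ.- a ℤ.- + n)) (+ M ℤ.+ b)
       ⊗  gauss (+ M ℤ.- b ℤ.+ half (+ L ℤ.+ a ℤ.- + n)) (+ M ℤ.- b)))
  else 0S

𝒰-summand : ∀ L M j n → n ≤ L →
  (𝒯-summand L M j j n ⊕ 𝒯-summand L M (j ℤ.+ + 1) j n)
  ≋ (tpow (n ℕ.* n) ⊗ (gauss (+ M) (+ n) ⊗ (G (L ∸ n ℕ.+ M) (+ M ℤ.+ j) ⊗ G (suc (L ∸ n ℕ.+ M)) (+ M ℤ.- j))))
𝒰-summand L M j n n≤L = begin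
  𝒯-summand L M j j n ⊕ 𝒯-summand L M (j ℤ.+ + 1) j n
    ≈⟨ ⊕-cong (if-cong (cong isEven (parity₁ (+ L) (+ n) j)) (≋-trans (factors _ _) (≡⇒≋ (cong (F _) (upper₁ (+ L) (+ n) j)))))
              (if-cong (cong isEven (parity₂ (+ L) (+ n) j)) (≋-trans (factors _ _) (≡⇒≋ (cong₂ F (lower₂ (+ L) (+ n) j) (upper₂ (+ L) (+ n) j))))) ⟩
  (if isEven (w ℤ.+ (d ℤ.+ d)) then F (half w) (half (w ℤ.+ (j ℤ.+ j))) else 0S) ⊕
  (if isEven (+ 1 ℤ.+ (w ℤ.+ (d ℤ.+ d))) then F (half (w ℤ.- + 1)) (half (+ 1 ℤ.+ (w ℤ.+ (j ℤ.+ j)))) else 0S)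
    ≈⟨ parity-select F w j d ⟩
  F ⌊ w /2⌋ᶻ ⌊ + 1 ℤ.+ (w ℤ.+ (j ℤ.+ j)) /2⌋ᶻ
    ≡⟨ cong₂ (λ a b → F ⌊ a /2⌋ᶻ ⌊ b /2⌋ᶻ) (sym G-arg₁) (sym G-arg₂) ⟩
  tpow (n ℕ.* n) ⊗ (gauss (+ M) (+ n) ⊗ (G x (+ M ℤ.+ j) ⊗ G (suc x) (+ M ℤ.- j))) ∎
  where
  open ≋-Reasoning
  x : ℕ
  x = L ∸ n ℕ.+ M
  w d : ℤ
  w = (+ L ℤ.- j) ℤ.- + n
  d = j ℤ.+ + n
  F : ℤ → ℤ → Series
  F e₁ e₂ = tpow (n ℕ.* n) ⊗ (gauss (+ M) (+ n) ⊗ (gaussℤ (+ M ℤ.+ j) e₁ ⊗ gaussℤ (+ M ℤ.- j) e₂))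
  factors : ∀ e₁ e₂ →
    (tpow (n ℕ.* n) ⊗ (gauss (+ M) (+ n) ⊗ (gauss (+ M ℤ.+ j ℤ.+ e₁) (+ M ℤ.+ j) ⊗ gauss (+ M ℤ.- j ℤ.+ e₂) (+ M ℤ.- j))))
    ≋ F e₁ e₂
  factors e₁ e₂ = ⊗-congˡ (tpow (n ℕ.* n)) (⊗-congˡ (gauss (+ M) (+ n)) (⊗-cong (gauss-+ (+ M ℤ.+ j) e₁) (gauss-+ (+ M ℤ.- j) e₂)))
  parity₁ : ∀ L n j → n ℤ.+ j ℤ.+ L ≡ ((L ℤ.- j) ℤ.- n) ℤ.+ ((j ℤ.+ n) ℤ.+ (j ℤ.+ n))
  parity₁ = solve-∀
  parity₂ : ∀ L n j → n ℤ.+ (j ℤ.+ + 1) ℤ.+ L ≡ + 1 ℤ.+ (((L ℤ.- j) ℤ.- n) ℤ.+ ((j ℤ.+ n) ℤ.+ (j ℤ.+ n)))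
  parity₂ = solve-∀
  upper₁ : ∀ L n j → half ((L ℤ.+ j) ℤ.- n) ≡ half (((L ℤ.- j) ℤ.- n) ℤ.+ (j ℤ.+ j))
  upper₁ L n j = cong half (regroup L n j)
    where
    regroup : ∀ L n j → (L ℤ.+ j) ℤ.- n ≡ ((L ℤ.- j) ℤ.- n) ℤ.+ (j ℤ.+ j)
    regroup = solve-∀
  lower₂ : ∀ L n j → half ((L ℤ.- (j ℤ.+ + 1)) ℤ.- n) ≡ half (((L ℤ.- j) ℤ.- n) ℤ.- + 1)
  lower₂ L n j = cong half (regroup L n j)
    where
    regroup : ∀ L n j → (L ℤ.- (j ℤ.+ + 1)) ℤ.- n ≡ ((L ℤ.- j) ℤ.- n) ℤ.- + 1
    regroup = solve-∀
  upper₂ : ∀ L n j → half ((L ℤ.+ (j ℤ.+ + 1)) ℤ.- n) ≡ half (+ 1 ℤ.+ (((L ℤ.- j) ℤ.- n) ℤ.+ (j ℤ.+ j)))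
  upper₂ L n j = cong half (regroup L n j)
    where
    regroup : ∀ L n j → (L ℤ.+ (j ℤ.+ + 1)) ℤ.- n ≡ + 1 ℤ.+ (((L ℤ.- j) ℤ.- n) ℤ.+ (j ℤ.+ j))
    regroup = solve-∀
  L∸n≡L-n : + (L ∸ n) ≡ + L ℤ.- + n
  L∸n≡L-n = sym (trans (ℤ.[+m]-[+n]≡m⊖n L n) (ℤ.⊖-≥ n≤L))
  G-arg₁ : + x ℤ.- (+ M ℤ.+ j) ≡ w
  G-arg₁ = trans (cong (λ r → (r ℤ.+ + M) ℤ.- (+ M ℤ.+ j)) L∸n≡L-n) (regroup (+ L) (+ n) (+ M) j)
    where
    regroup : ∀ L n M j → ((L ℤ.- n) ℤ.+ M) ℤ.- (M ℤ.+ j) ≡ (L ℤ.- j) ℤ.- n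
    regroup = solve-∀
  G-arg₂ : + suc x ℤ.- (+ M ℤ.- j) ≡ + 1 ℤ.+ (w ℤ.+ (j ℤ.+ j))
  G-arg₂ = trans (cong (λ r → (+ 1 ℤ.+ (r ℤ.+ + M)) ℤ.- (+ M ℤ.- j)) L∸n≡L-n) (regroup (+ L) (+ n) (+ M) j)
    where
    regroup : ∀ L n M j → (+ 1 ℤ.+ ((L ℤ.- n) ℤ.+ M)) ℤ.- (M ℤ.- j) ≡ + 1 ℤ.+ (((L ℤ.- j) ℤ.- n) ℤ.+ (j ℤ.+ j))
    regroup = solve-∀

sumS : ℕ → (ℕ → Series) → Series
sumS N f k = sumℕ N (λ n → f n k)

sumS-cong : ∀ N {f g : ℕ → Series} → (∀ n → n < N → f n ≋ g n) → sumS N f ≋ sumS N g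
sumS-cong N eq k = sumℕ-cong N (λ n n<N → eq n n<N k)

sumS-zero : ∀ N {f : ℕ → Series} → (∀ n → f n ≋ 0S) → sumS N f ≋ 0S
sumS-zero N eq k = sumℕ-zero N (λ n _ → eq n k)

⊗-distribˡ-sumS : ∀ N c (f : ℕ → Series) → (c ⊗ sumS N f) ≋ sumS N (λ n → c ⊗ f n)
⊗-distribˡ-sumS zero    c f = ⊗-zeroʳ c
⊗-distribˡ-sumS (suc N) c f k =
  trans (⊗-distribˡ-⊕ c (sumS N f) (f N) k) (cong (ℤ._+ (c ⊗ f N) k) (⊗-distribˡ-sumS N c f k))

symSum-sumS : ∀ N K (H : ℕ → ℤ → Series) → symSum N (λ j → sumS K (λ n → H n j)) ≋ sumS K (λ n → symSum N (H n))
symSum-sumS zero    K H k = refl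
symSum-sumS (suc N) K H k =
  trans (cong (ℤ._+ sumS K (λ n → H n -[1+ N ]) k)
              (trans (cong (ℤ._+ sumS K (λ n → H n (+ suc N)) k) (symSum-sumS N K H k))
                     (sym (sumℕ-distrib-+ K _ _))))
        (sym (sumℕ-distrib-+ K _ _))

weight : ℕ → ℕ → Series
weight M n = tpow (n ℕ.* n) ⊗ gauss (+ M) (+ n)

offset : ℕ → ℕ → ℕ → ℕ
offset L M n = L ∸ n ℕ.+ M

lemmaTerm≋sumS : ∀ L M j → lemmaTerm L M j ≋ sumS (suc L) (λ n → weight M n ⊗ altTerm (offset L M n) M j)
lemmaTerm≋sumS L M j = begin
  scale s (E ⊗ 𝒰 L M j j)
    ≈⟨ scale-cong s (⊗-congˡ E 𝒰≋) ⟩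
  scale s (E ⊗ sumS (suc L) f)
    ≈⟨ scale≋constS-⊗ s (E ⊗ sumS (suc L) f) ⟩
  constS s ⊗ (E ⊗ sumS (suc L) f)
    ≈⟨ ⊗-assoc (constS s) E (sumS (suc L) f) ⟨
  (constS s ⊗ E) ⊗ sumS (suc L) f
    ≈⟨ ⊗-distribˡ-sumS (suc L) (constS s ⊗ E) f ⟩
  sumS (suc L) (λ n → (constS s ⊗ E) ⊗ f n)
    ≈⟨ sumS-cong (suc L) (λ n _ → rearrange n) ⟩
  sumS (suc L) (λ n → weight M n ⊗ altTerm (offset L M n) M j) ∎
  where
  open ≋-Reasoning
  s : ℤ
  s = sgn j
  E : Series
  E = tpow (triangular j)
  GG : ℕ → Series
  GG n = G (offset L M n) (+ M ℤ.+ j) ⊗ G (suc (offset L M n)) (+ M ℤ.- j)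
  f : ℕ → Series
  f n = tpow (n ℕ.* n) ⊗ (gauss (+ M) (+ n) ⊗ GG n)
  𝒰≋ : 𝒰 L M j j ≋ sumS (suc L) f
  𝒰≋ k = trans (sym (sumℕ-distrib-+ (suc L) (λ n → 𝒯-summand L M j j n k) (λ n → 𝒯-summand L M (j ℤ.+ + 1) j n k)))
               (sumℕ-cong (suc L) (λ n n<1+L → 𝒰-summand L M j n (ℕ.≤-pred n<1+L) k))
  rearrange : ∀ n → ((constS s ⊗ E) ⊗ f n) ≋ (weight M n ⊗ altTerm (offset L M n) M j)
  rearrange n = begin
    (constS s ⊗ E) ⊗ (tpow (n ℕ.* n) ⊗ (gauss (+ M) (+ n) ⊗ GG n))
      ≈⟨ solve 5 (λ c E T B P → (c :* E) :* (T :* (B :* P)) := (T :* B) :* (c :* (E :* P)))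
               (λ k → refl) (constS s) E (tpow (n ℕ.* n)) (gauss (+ M) (+ n)) (GG n) ⟩
    weight M n ⊗ (constS s ⊗ (E ⊗ GG n))
      ≈⟨ ⊗-congˡ (weight M n) (scale≋constS-⊗ s (E ⊗ GG n)) ⟨
    weight M n ⊗ altTerm (offset L M n) M j ∎

lemmaTerm-vanishes : ∀ L M j → M < ∣ j ∣ → lemmaTerm L M j ≋ 0S
lemmaTerm-vanishes L M j M<∣j∣ = ≋-trans (lemmaTerm≋sumS L M j)
  (sumS-zero (suc L) (λ n → ≋-trans (⊗-congˡ (weight M n) (altTerm-vanishes (offset L M n) j M<∣j∣)) (⊗-zeroʳ (weight M n))))
  where
  M-b≡-[1+b∸1+M] : ∀ {b} → M < b → + M ℤ.- + b ≡ -[1+ b ∸ suc M ]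
  M-b≡-[1+b∸1+M] {b} M<b = trans (ℤ.[+m]-[+n]≡m⊖n M b) (trans (ℤ.⊖-< M<b) (cong (λ z → ℤ.- (+ z)) (ℕ.+-∸-assoc 1 M<b)))
  altTerm-vanishes : ∀ x j → M < ∣ j ∣ → altTerm x M j ≋ 0S
  altTerm-vanishes x (+ b) M<b = scale-⊗-vanishesʳ (sgn (+ b)) (tpow (triangular (+ b))) (G x (+ M ℤ.+ + b))
    (≡⇒≋ (cong (G (suc x)) (M-b≡-[1+b∸1+M] M<b)))
  altTerm-vanishes x -[1+ b ] M<1+b = scale-⊗-vanishesˡ (sgn -[1+ b ]) (tpow (triangular -[1+ b ])) (G (suc x) (+ M ℤ.- -[1+ b ]))
    (≡⇒≋ (cong (G x) (M-b≡-[1+b∸1+M] M<1+b)))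

sumS-weight-δ0 : ∀ L M → sumS (suc L) (λ n → weight M n ⊗ δ0 M) ≋ δ0 M
sumS-weight-δ0 L (suc m) = sumS-zero (suc L) (λ n → ⊗-zeroʳ (weight (suc m) n))
sumS-weight-δ0 L zero    k = trans (sumℕ-head L _) (trans (cong₂ ℤ._+_ first rest) (ℤ.+-identityʳ _))
  where
  -- [0 ; n] = δ_{n,0}
  first : (weight 0 0 ⊗ 1S) k ≡ 1S k
  first = trans (⊗-identityʳ (weight 0 0) k) (⊗-identityˡ 1S k)
  rest : sumℕ L (λ n → (weight 0 (suc n) ⊗ 1S) k) ≡ + 0
  rest = sumℕ-zero L (λ n _ → trans (⊗-identityʳ (weight 0 (suc n)) k) (⊗-zeroʳ (tpow (suc n ℕ.* suc n)) k))

symSum-lemmaTerm : ∀ L M → symSum M (lemmaTerm L M) ≋ δ0 M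
symSum-lemmaTerm L M = begin
  symSum M (lemmaTerm L M)
    ≈⟨ symSum-cong M (lemmaTerm≋sumS L M) ⟩
  symSum M (λ j → sumS (suc L) (λ n → weight M n ⊗ altTerm (offset L M n) M j))
    ≈⟨ symSum-sumS M (suc L) (λ n j → weight M n ⊗ altTerm (offset L M n) M j) ⟩
  sumS (suc L) (λ n → symSum M (λ j → weight M n ⊗ altTerm (offset L M n) M j))
    ≈⟨ sumS-cong (suc L) (λ n _ → ⊗-distribˡ-symSum M (weight M n) (altTerm (offset L M n) M)) ⟩
  sumS (suc L) (λ n → weight M n ⊗ altSum (offset L M n) M)
    ≈⟨ sumS-cong (suc L) (λ n _ → ⊗-congˡ (weight M n) (altSum≋δ0 (offset L M n) M)) ⟩
  sumS (suc L) (λ n → weight M n ⊗ δ0 M)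
    ≈⟨ sumS-weight-δ0 L M ⟩
  δ0 M ∎
  where open ≋-Reasoning

lemma4p2 : (L M : ℕ) → Σ ℕ (λ N → ((j : ℤ) → N < ∣ j ∣ → lemmaTerm L M j ≋ 0S) × (symSum N (lemmaTerm L M) ≋ δ0 M))
lemma4p2 L M = M , lemmaTerm-vanishes L M , symSum-lemmaTerm L M
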